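{- For integers $m,n\ge 2$, let $\mathcal{P}$ be a coarsening of the column set of $mP_n$ and let $F$ be a symmetric subset of $\mathcal{P}^2$. If $(X,X')\in F$ for some $X,X'\in\mathcal{P}$, then the $(\mathcal{P},F)$-flip of $mP_n$ has at least one edge with one end in $X$ and the other end in $X'$, whose one end is in the $(m-1)$-th row of $mP_n$ and whose other end is in the $m$-th row of $mP_n$.
   Context: $mP_n$ is the disjoint union of $m$ copies of the path $P_n$, with vertex set $[m]\times[n]$, where $(i,j)$ is the $j$-th vertex of the $i$-th path; the $i$-th row is the subpath on $\{i\}\times[n]$, the $j$-th column is $\{(i,j):i\in[m]\}$, and the column set is the set of all columns. A coarsening of a collection $\mathcal{P}$ of disjoint sets is a collection of pairwise disjoint non-empty sets each a union of members of $\mathcal{P}$. A subset $F\subseteq\mathcal{P}^2$ is symmetric if $(X,X')\in F\Rightarrow(X',X)\in F$. For a graph $H$ and collection $\mathcal{P}$ of pairwise disjoint non-empty subsets of $V(H)$, let $\mathcal{P}(v)$ be the member of $\mathcal{P}$ containing $v$ if any, else $\{v\}$. The $(\mathcal{P},F)$-flip of $H$ has vertex set $V(H)$ and distinct $u,v$ adjacent iff either $uv\notin E(H)$ and $(\mathcal{P}(u),\mathcal{P}(v))\in F$, or $uv\in E(H)$ and $(\mathcal{P}(u),\mathcal{P}(v))\notin F$. -}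

module Defs where

open import Data.Nat using (ℕ; suc; _∸_)
open import Data.Fin using (Fin; toℕ)
open import Data.Product using (_×_; _,_; ∃; ∃₂; proj₁)
open import Data.Sum using (_⊎_)
open import Relation.Nullary using (¬_)
open import Relation.Binary.PropositionalEquality using (_≡_; _≢_)

-- Vertices of mP_n: (i , j) is the j-th vertex of the i-th path
-- (0-indexed: row i ∈ Fin m, column j ∈ Fin n).
Vertex : ℕ → ℕ → Set
Vertex m n = Fin m × Fin n

row : ∀ {m n} → Vertex m n → ℕ
row (i , _) = toℕ i

Edge : ∀ {m n} → Vertex m n → Vertex m n → Set
Edge (i , j) (i' , j') = i ≡ i' × (toℕ j' ≡ suc (toℕ j) ⊎ toℕ j ≡ suc (toℕ j'))

record Coarsening (m n : ℕ) : Set₁ where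
  field
    k         : ℕ
    part      : Fin k → Vertex m n → Set
    nonempty  : ∀ a → ∃ λ v → part a v
    disjoint  : ∀ a b v → part a v → part b v → a ≡ b
    columnUnion : ∀ a i i' j → part a (i , j) → part a (i' , j)

open Coarsening public

SymmetricRel : ∀ {k} → (Fin k → Fin k → Set) → Set
SymmetricRel {k} F = ∀ (a b : Fin k) → F a b → F b a

-- Since members of P are pairwise disjoint this says exactly
-- that P(u) and P(v) are members of P and the pair is in F (if u is covered by
-- no member, P(u) = {u} is not a member of P).
InF : ∀ {m n} (P : Coarsening m n) → (Fin (k P) → Fin (k P) → Set) →
      Vertex m n → Vertex m n → Set
InF P F u v = ∃₂ λ a b → part P a u × part P b v × F a b

FlipAdj : ∀ {m n} (P : Coarsening m n) → (Fin (k P) → Fin (k P) → Set) →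
          Vertex m n → Vertex m n → Set
FlipAdj P F u v =
  u ≢ v × ((¬ Edge u v × InF P F u v) ⊎ (Edge u v × ¬ InF P F u v))

-- Every member of P is a union of columns, so it meets every row.  Take u ∈ X in
-- row m−2 and v ∈ X' in row m−1: lying in different paths, u and v are not
-- adjacent in mP_n, and (X, X') ∈ F therefore makes them adjacent in the flip.
module Submission where

open import Defs
open import Data.Nat using (ℕ; suc; _≤_; _∸_; s≤s)
open import Data.Fin using (Fin; toℕ; fromℕ; inject₁)
open import Data.Fin.Properties using (toℕ-fromℕ; toℕ-inject₁; fromℕ≢inject₁)
open import Data.Product using (_×_; ∃; ∃₂; _,_; proj₁)
open import Data.Sum using (_⊎_; inj₁)
open import Relation.Binary.PropositionalEquality using (_≡_; _≢_; cong; trans; sym)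

Edge⇒sameRow : ∀ {m n} {u v : Vertex m n} → Edge u v → proj₁ u ≡ proj₁ v
Edge⇒sameRow (i≡i' , _) = i≡i'

part-meetsRow : ∀ {m n} (P : Coarsening m n) a (i : Fin m) → ∃ λ j → part P a (i , j)
part-meetsRow P a i with nonempty P a
... | (i₀ , j) , p = j , columnUnion P a i₀ i j p

flipAdj-acrossRows : ∀ {m n} (P : Coarsening m n) (F : Fin (k P) → Fin (k P) → Set)
  {a b} {u v : Vertex m n} → proj₁ u ≢ proj₁ v →
  part P a u → part P b v → F a b → FlipAdj P F u v
flipAdj-acrossRows P F rows≢ pu pv fab =
  (λ u≡v → rows≢ (cong proj₁ u≡v)) ,
  inj₁ ((λ e → rows≢ (Edge⇒sameRow e)) , _ , _ , pu , pv , fab)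

toℕ-inject₁-fromℕ : ∀ n → toℕ (inject₁ (fromℕ n)) ≡ n
toℕ-inject₁-fromℕ n = trans (toℕ-inject₁ (fromℕ n)) (toℕ-fromℕ n)

lemma3p6 : (m n : ℕ) → 2 ≤ m → 2 ≤ n → (P : Coarsening m n) →
    (F : Fin (k P) → Fin (k P) → Set) → SymmetricRel F →
    (X X' : Fin (k P)) → F X X' →
    ∃₂ λ (u v : Vertex m n) → part P X u × part P X' v × FlipAdj P F u v ×
    ((row u ≡ m ∸ 2 × row v ≡ m ∸ 1) ⊎ (row u ≡ m ∸ 1 × row v ≡ m ∸ 2))
lemma3p6 _ _ (s≤s (s≤s {n = m'} _)) _ P F _ X X' fXX'
  with part-meetsRow P X (inject₁ (fromℕ m')) | part-meetsRow P X' (fromℕ (suc m'))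
... | _ , pu | _ , pv =
  _ , _ , pu , pv ,
  flipAdj-acrossRows P F (λ e → fromℕ≢inject₁ (sym e)) pu pv fXX' ,
  inj₁ (toℕ-inject₁-fromℕ m' , toℕ-fromℕ (suc m'))
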